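{- Let $\kappa\ge 3$ and $\lambda\ge 0$ be integers with $\lambda\le\kappa-2$, and let $\mathcal{G}=\big((\gamma_i,\alpha_i,\beta_i)\big)_{i=1}^{g+1}$ be a $(\kappa,\lambda)$-graphical sequence. For $1\le i\le g$ put $\mathfrak{R}_i=\alpha_i+2\sqrt{\beta_i\gamma_i}$. Then: (i) $\mathfrak{R}_i\ge\mathfrak{R}_1$ for all $1\le i\le g$, with equality if and only if $(\gamma_i,\alpha_i,\beta_i)\in\{(1,\lambda,\kappa-\lambda-1),(\kappa-\lambda-1,\lambda,1)\}$; (ii) for any $2\le i\le g$, if $\beta_i\ge\gamma_i$ then $\mathfrak{R}_{i-1}<\mathfrak{R}_i$; (iii) for any $2\le i\le g-1$, if $\beta_i\le\gamma_i$ then $\mathfrak{R}_{i+1}<\mathfrak{R}_i$. In particular the sequence $(\mathfrak{R}_i)_{i=1}^g$ is unimodal, i.e. there is $1\le t\le g$ with $\mathfrak{R}_1\le\dots\le\mathfrak{R}_t$ and $\mathfrak{R}_t\ge\dots\ge\mathfrak{R}_g$.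
   Context: $\mathbb{N}_0$ denotes the non-negative integers. For integers $\kappa\ge3$, $0\le\lambda\le\kappa-2$, let $V_{\kappa,\lambda}=\{(\gamma,\alpha,\beta)\in\mathbb{N}_0^3:\beta,\gamma\ge1,\ \gamma+\alpha+\beta=\kappa,\ \alpha\ge\max\{\lambda+1-\beta,\lambda+1-\gamma\}\}$. A sequence $\mathcal{G}=\big((\gamma_i,\alpha_i,\beta_i)\big)_{i=1}^{g+1}$ of pairwise distinct elements of $\mathbb{N}_0^3$ is a $(\kappa,\lambda)$-graphical sequence if: (G0) $(\gamma_i,\alpha_i,\beta_i)\in V_{\kappa,\lambda}$ for $1\le i\le g$; (G1) $(\gamma_1,\alpha_1,\beta_1)=(1,\lambda,\kappa-\lambda-1)$; (G2) $\beta_i\ge\beta_{i+1}$ for $1\le i\le g-1$ and $\gamma_i\le\gamma_{i+1}$ for $1\le i\le g$; (G3) $\beta_{g+1}=0$ and $\gamma_{g+1}+\alpha_{g+1}=\kappa$. -}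

module Defs where

open import Data.Nat as ℕ using (ℕ; _+_; _*_; _∸_; _≤_; _<_; _≥_)
open import Data.Integer using (+_)
open import Data.Rational as ℚ using (ℚ; _/_; 0ℚ)
open import Data.Product using (_×_; _,_; Σ; ∃)
open import Data.Sum using (_⊎_)
open import Relation.Nullary using (¬_)
open import Relation.Binary.PropositionalEquality using (_≡_; _≢_)

ℕ→ℚ : ℕ → ℚ
ℕ→ℚ n = (+ n) / 1

-- The real number  a + 2 √p  (a p : ℕ) is represented by the pair (a , p).
-- It is handled through its lower Dedekind cut:  r <ˢ (a , p)  means
-- r < a + 2√p, i.e.  r - a < 0  or  (r - a)² < 4 p.
Surd : Set
Surd = ℕ × ℕ

_<ˢ_ : ℚ → Surd → Set
r <ˢ (a , p) = ((r ℚ.- ℕ→ℚ a) ℚ.< 0ℚ) ⊎ (((r ℚ.- ℕ→ℚ a) ℚ.* (r ℚ.- ℕ→ℚ a)) ℚ.< ℕ→ℚ (4 * p))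

infix 4 _≤ᴿ_ _<ᴿ_ _≈ᴿ_

_≤ᴿ_ : Surd → Surd → Set
x ≤ᴿ y = ∀ (r : ℚ) → r <ˢ x → r <ˢ y

_≈ᴿ_ : Surd → Surd → Set
x ≈ᴿ y = (x ≤ᴿ y) × (y ≤ᴿ x)

_<ᴿ_ : Surd → Surd → Set
x <ᴿ y = Σ ℚ (λ r → (¬ (r <ˢ x)) × (r <ˢ y))

Triple : Set
Triple = ℕ × ℕ × ℕ   -- (γ , α , β)

InV : ℕ → ℕ → Triple → Set
InV κ λ' (γ , α , β) =
  (1 ≤ β) × (1 ≤ γ) × (γ + α + β ≡ κ) × ((λ' + 1) ∸ β ≤ α) × ((λ' + 1) ∸ γ ≤ α)

-- A sequence indexed by 1 … g+1 is given as a function ℕ → Triple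
-- (values outside 1 … g+1 are irrelevant).
γ_ α_ β_ : Triple → ℕ
γ_ (c , a , b) = c
α_ (c , a , b) = a
β_ (c , a , b) = b

record Graphical (κ λ' g : ℕ) (G : ℕ → Triple) : Set where
  field
    distinct : ∀ i j → 1 ≤ i → i ≤ g + 1 → 1 ≤ j → j ≤ g + 1 → i ≢ j → G i ≢ G j
    G0 : ∀ i → 1 ≤ i → i ≤ g → InV κ λ' (G i)
    G1 : G 1 ≡ (1 , λ' , κ ∸ λ' ∸ 1)
    G2β : ∀ i → 1 ≤ i → i ≤ g ∸ 1 → β_ (G (i + 1)) ≤ β_ (G i)
    G2γ : ∀ i → 1 ≤ i → i ≤ g → γ_ (G i) ≤ γ_ (G (i + 1))
    G3 : (β_ (G (g + 1)) ≡ 0) × (γ_ (G (g + 1)) + α_ (G (g + 1)) ≡ κ)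

𝔑 : Triple → Surd
𝔑 (γ , α , β) = (α , β * γ)

-- Since γ + α + β = κ, we have 𝔑(γ, α, β) = α + 2√(βγ) = κ − (√β − √γ)². Along a graphical
-- sequence γ increases and β decreases, so 𝔑 increases while γ ≤ β and decreases once β ≤ γ,
-- and over V_{κ,λ} it is smallest where |√β − √γ| is largest, namely at (1, λ, κ−λ−1) and its
-- mirror image (κ−λ−1, λ, 1). Every such comparison is a chain of two unit moves, one unit from β
-- to α and one unit from α to γ, each of which raises 𝔑. Scaled by a denominator d, the cut of a + 2√p becomes the
-- set of integers below a·d + ⌈2d√p⌉, so comparisons of cuts reduce to integer inequalities about
-- ceiling square roots; the strict ones are witnessed at one well-chosen denominator.
module Submission where

open import Defs
open import Data.Nat as ℕ using (ℕ; zero; suc; _+_; _*_; _∸_; _≤_; _<_; _≥_; z≤n; s≤s; NonZero; _≤?_; _<?_)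
import Data.Nat.Properties as ℕₚ
open import Data.Nat.Tactic.RingSolver using (solve)
open import Data.Integer as ℤ using (ℤ; +_; -[1+_]; 0ℤ; +<+; -<+)
import Data.Integer.Properties as ℤₚ
import Data.Integer.Tactic.RingSolver as ℤ-Solver
open import Data.Rational as ℚ using (ℚ; mkℚ; 0ℚ; toℚᵘ; fromℚᵘ)
import Data.Rational.Properties as ℚₚ
open import Data.Rational.Unnormalised as ℚᵘ using (ℚᵘ; mkℚᵘ; *<*; _≃_)
import Data.Rational.Unnormalised.Properties as ℚᵘₚ
open import Data.List using (_∷_; [])
open import Data.Product using (_×_; _,_; Σ; proj₁; proj₂)
open import Data.Product.Properties using (≡-dec)
open import Data.Sum using (_⊎_; inj₁; inj₂; swap; [_,_]′)
open import Data.Empty using (⊥-elim)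
open import Function using (_∘_)
open import Relation.Nullary using (¬_; Dec; yes; no)
open import Relation.Nullary.Decidable using (_⊎-dec_)
open import Relation.Binary.PropositionalEquality

m*m≤n*n⇒m≤n : ∀ {m n} → m * m ≤ n * n → m ≤ n
m*m≤n*n⇒m≤n {m} {n} mm≤nn with m ≤? n
... | yes m≤n = m≤n
... | no  m≰n = ⊥-elim (ℕₚ.<⇒≱ (ℕₚ.*-mono-< n<m n<m) mm≤nn) where n<m = ℕₚ.≰⇒> m≰n

m*m<n*n⇒m<n : ∀ {m n} → m * m < n * n → m < n
m*m<n*n⇒m<n {m} {n} mm<nn with m <? n
... | yes m<n = m<n
... | no  m≮n = ⊥-elim (ℕₚ.<⇒≱ mm<nn (ℕₚ.*-mono-≤ n≤m n≤m)) where n≤m = ℕₚ.≮⇒≥ m≮n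

ceilSqrt : ℕ → ℕ
ceilSqrt zero = zero
ceilSqrt (suc m) with suc m ≤? ceilSqrt m * ceilSqrt m
... | yes _ = ceilSqrt m
... | no  _ = suc (ceilSqrt m)

≤-ceilSqrt² : ∀ m → m ≤ ceilSqrt m * ceilSqrt m
ceilSqrt-least : ∀ m {w} → m ≤ w * w → ceilSqrt m ≤ w

≤-ceilSqrt² zero = z≤n
≤-ceilSqrt² (suc m) with suc m ≤? ceilSqrt m * ceilSqrt m
... | yes m<s² = m<s²
... | no  _    = s≤s (ℕₚ.≤-trans (≤-ceilSqrt² m)
  (ℕₚ.≤-trans (ℕₚ.*-monoʳ-≤ (ceilSqrt m) (ℕₚ.n≤1+n _)) (ℕₚ.m≤n+m _ (ceilSqrt m))))

ceilSqrt-least zero m≤w² = z≤n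
ceilSqrt-least (suc m) {w} m<w² with suc m ≤? ceilSqrt m * ceilSqrt m
... | yes _    = ceilSqrt-least m (ℕₚ.<⇒≤ m<w²)
... | no  m≮s² = m*m<n*n⇒m<n (ℕₚ.≤-<-trans (ℕₚ.≤-pred (ℕₚ.≰⇒> m≮s²)) m<w²)

ceilSqrt≤⇒≤² : ∀ {m w} → ceilSqrt m ≤ w → m ≤ w * w
ceilSqrt≤⇒≤² {m} s≤w = ℕₚ.≤-trans (≤-ceilSqrt² m) (ℕₚ.*-mono-≤ s≤w s≤w)

²<⇒<ceilSqrt : ∀ {m w} → w * w < m → w < ceilSqrt m
²<⇒<ceilSqrt {m} {w} w²<m = ℕₚ.≰⇒> λ s≤w → ℕₚ.<⇒≱ w²<m (ceilSqrt≤⇒≤² s≤w)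

<ceilSqrt⇒²< : ∀ {m w} → w < ceilSqrt m → w * w < m
<ceilSqrt⇒²< {m} {w} w<s = ℕₚ.≰⇒> λ m≤w² → ℕₚ.<⇒≱ w<s (ceilSqrt-least m m≤w²)

ceilSqrt-pred : ∀ m → Σ ℕ λ t → ceilSqrt m ≤ suc t × t * t ≤ m
ceilSqrt-pred m with ceilSqrt m in eq
... | zero  = zero , z≤n , z≤n
... | suc t = t , ℕₚ.≤-refl , ℕₚ.<⇒≤ (<ceilSqrt⇒²< (subst (t <_) (sym eq) ℕₚ.≤-refl))

-- Scaled by d, the lower cut of a + 2√p is the set of integers below this threshold.
threshold : ℕ → Surd → ℕ
threshold d (a , p) = a * d + ceilSqrt (4 * p * (d * d))

ℕ→ℚᵘ : ℕ → ℚᵘ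
ℕ→ℚᵘ a = mkℚᵘ (+ a) 0

-- The cut `_<ˢ_` read in ℚᵘ, whose arithmetic does not normalise fractions.
LowerCutᵘ : Surd → ℚᵘ → Set
LowerCutᵘ (a , p) u =
  ((u ℚᵘ.- ℕ→ℚᵘ a) ℚᵘ.< ℚᵘ.0ℚᵘ) ⊎ ((u ℚᵘ.- ℕ→ℚᵘ a) ℚᵘ.* (u ℚᵘ.- ℕ→ℚᵘ a) ℚᵘ.< ℕ→ℚᵘ (4 * p))

module _ (r : ℚ) (a : ℕ) where

  private
    toℚᵘ-ℕ→ℚ : ∀ m → toℚᵘ (ℕ→ℚ m) ≃ ℕ→ℚᵘ m
    toℚᵘ-ℕ→ℚ m = ℚₚ.toℚᵘ-fromℚᵘ (ℕ→ℚᵘ m)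

    toℚᵘ-diff : toℚᵘ (r ℚ.- ℕ→ℚ a) ≃ toℚᵘ r ℚᵘ.- ℕ→ℚᵘ a
    toℚᵘ-diff = ℚᵘₚ.≃-trans (ℚₚ.toℚᵘ-homo-+ r (ℚ.- ℕ→ℚ a))
      (ℚᵘₚ.+-cong (ℚᵘₚ.≃-refl {toℚᵘ r}) (ℚᵘₚ.≃-trans (ℚₚ.toℚᵘ-homo‿- (ℕ→ℚ a)) (ℚᵘₚ.-‿cong (toℚᵘ-ℕ→ℚ a))))

    toℚᵘ-diff² : toℚᵘ ((r ℚ.- ℕ→ℚ a) ℚ.* (r ℚ.- ℕ→ℚ a)) ≃ (toℚᵘ r ℚᵘ.- ℕ→ℚᵘ a) ℚᵘ.* (toℚᵘ r ℚᵘ.- ℕ→ℚᵘ a)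
    toℚᵘ-diff² = ℚᵘₚ.≃-trans (ℚₚ.toℚᵘ-homo-* (r ℚ.- ℕ→ℚ a) (r ℚ.- ℕ→ℚ a)) (ℚᵘₚ.*-cong toℚᵘ-diff toℚᵘ-diff)

  <ˢ⇒LowerCutᵘ : ∀ p → r <ˢ (a , p) → LowerCutᵘ (a , p) (toℚᵘ r)
  <ˢ⇒LowerCutᵘ p (inj₁ h) = inj₁ (ℚᵘₚ.<-respˡ-≃ toℚᵘ-diff (ℚₚ.toℚᵘ-mono-< h))
  <ˢ⇒LowerCutᵘ p (inj₂ h) =
    inj₂ (ℚᵘₚ.<-respʳ-≃ (toℚᵘ-ℕ→ℚ (4 * p)) (ℚᵘₚ.<-respˡ-≃ toℚᵘ-diff² (ℚₚ.toℚᵘ-mono-< h)))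

  LowerCutᵘ⇒<ˢ : ∀ p → LowerCutᵘ (a , p) (toℚᵘ r) → r <ˢ (a , p)
  LowerCutᵘ⇒<ˢ p (inj₁ h) = inj₁ (ℚₚ.toℚᵘ-cancel-< (ℚᵘₚ.<-respˡ-≃ (ℚᵘₚ.≃-sym toℚᵘ-diff) h))
  LowerCutᵘ⇒<ˢ p (inj₂ h) = inj₂ (ℚₚ.toℚᵘ-cancel-<
    (ℚᵘₚ.<-respʳ-≃ (ℚᵘₚ.≃-sym (toℚᵘ-ℕ→ℚ (4 * p))) (ℚᵘₚ.<-respˡ-≃ (ℚᵘₚ.≃-sym toℚᵘ-diff²) h)))

LowerCutᵘ-resp-≃ : ∀ x {u v} → u ≃ v → LowerCutᵘ x u → LowerCutᵘ x v
LowerCutᵘ-resp-≃ (a , p) u≃v (inj₁ h) = inj₁ (ℚᵘₚ.<-respˡ-≃ (ℚᵘₚ.+-cong u≃v ℚᵘₚ.≃-refl) h)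
LowerCutᵘ-resp-≃ (a , p) u≃v (inj₂ h) = inj₂ (ℚᵘₚ.<-respˡ-≃ (ℚᵘₚ.*-cong diff diff) h)
  where diff = ℚᵘₚ.+-cong u≃v (ℚᵘₚ.≃-refl {ℚᵘ.- ℕ→ℚᵘ a})

neg⊎²<⇒<ceilSqrt : ∀ z m → (z ℤ.< 0ℤ) ⊎ (z ℤ.* z ℤ.< + m) → z ℤ.< + ceilSqrt m
neg⊎²<⇒<ceilSqrt -[1+ _ ] m _ = -<+
neg⊎²<⇒<ceilSqrt (+ w) m (inj₁ (+<+ ()))
neg⊎²<⇒<ceilSqrt (+ w) m (inj₂ w²<m) =
  +<+ (²<⇒<ceilSqrt (ℤₚ.drop‿+<+ (subst (ℤ._< + m) (sym (ℤₚ.pos-* w w)) w²<m)))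

<ceilSqrt⇒neg⊎²< : ∀ z m → z ℤ.< + ceilSqrt m → (z ℤ.< 0ℤ) ⊎ (z ℤ.* z ℤ.< + m)
<ceilSqrt⇒neg⊎²< -[1+ _ ] m _ = inj₁ -<+
<ceilSqrt⇒neg⊎²< (+ w) m (+<+ w<s) = inj₂ (subst (ℤ._< + m) (ℤₚ.pos-* w w) (+<+ (<ceilSqrt⇒²< w<s)))

module _ (n : ℤ) (dm a p : ℕ) where

  private
    d = suc dm
    z = n ℤ.- + a ℤ.* + d

    -- the numerators produced by ℚᵘ arithmetic on n / d - a
    numerator≡ : (n ℤ.* + 1 ℤ.+ ℤ.- (+ a) ℤ.* + d) ℤ.* + 1 ≡ z
    numerator≡ = ring-identity n (+ a) (+ d)
      where ring-identity : ∀ n a d → (n ℤ.* + 1 ℤ.+ ℤ.- a ℤ.* d) ℤ.* + 1 ≡ n ℤ.- a ℤ.* d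
            ring-identity = ℤ-Solver.solve-∀

    numerator²≡ : (n ℤ.* + 1 ℤ.+ ℤ.- (+ a) ℤ.* + d) ℤ.* (n ℤ.* + 1 ℤ.+ ℤ.- (+ a) ℤ.* + d) ℤ.* + 1 ≡ z ℤ.* z
    numerator²≡ = ring-identity n (+ a) (+ d)
      where ring-identity : ∀ n a d → (n ℤ.* + 1 ℤ.+ ℤ.- a ℤ.* d) ℤ.* (n ℤ.* + 1 ℤ.+ ℤ.- a ℤ.* d) ℤ.* + 1
                              ≡ (n ℤ.- a ℤ.* d) ℤ.* (n ℤ.- a ℤ.* d)
            ring-identity = ℤ-Solver.solve-∀

    bound≡ : + (4 * p) ℤ.* + (suc (dm * 1) * suc (dm * 1)) ≡ + (4 * p * (d * d))
    bound≡ rewrite ℕₚ.*-identityʳ dm = sym (ℤₚ.pos-* (4 * p) (d * d))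

    shift≡ : z ℤ.+ + (a * d) ≡ n
    shift≡ = trans (cong (λ t → z ℤ.+ t) (ℤₚ.pos-* a d)) (ring-identity n (+ a) (+ d))
      where ring-identity : ∀ n a d → n ℤ.- a ℤ.* d ℤ.+ a ℤ.* d ≡ n
            ring-identity = ℤ-Solver.solve-∀

    sum≡ : ∀ c → + c ℤ.+ + (a * d) ≡ + (a * d + c)
    sum≡ c = trans (ℤₚ.+-comm (+ c) (+ (a * d))) (sym (ℤₚ.pos-+ (a * d) c))

  LowerCutᵘ⇒<threshold : LowerCutᵘ (a , p) (mkℚᵘ n dm) → n ℤ.< + threshold d (a , p)
  LowerCutᵘ⇒<threshold cut = subst₂ ℤ._<_ shift≡ (sum≡ _)
      (ℤₚ.+-monoˡ-< (+ (a * d)) (neg⊎²<⇒<ceilSqrt z _ (lift cut)))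
    where
    lift : LowerCutᵘ (a , p) (mkℚᵘ n dm) → (z ℤ.< 0ℤ) ⊎ (z ℤ.* z ℤ.< + (4 * p * (d * d)))
    lift (inj₁ (*<* h)) = inj₁ (subst₂ ℤ._<_ numerator≡ refl h)
    lift (inj₂ (*<* h)) = inj₂ (subst₂ ℤ._<_ numerator²≡ bound≡ h)

  <threshold⇒LowerCutᵘ : n ℤ.< + threshold d (a , p) → LowerCutᵘ (a , p) (mkℚᵘ n dm)
  <threshold⇒LowerCutᵘ n<t = lower (<ceilSqrt⇒neg⊎²< z _ z<s)
    where
    z<s : z ℤ.< + ceilSqrt (4 * p * (d * d))
    z<s = ℤₚ.≰⇒> λ s≤z → ℤₚ.<⇒≱ n<t (subst₂ ℤ._≤_ (sum≡ _) shift≡ (ℤₚ.+-monoˡ-≤ (+ (a * d)) s≤z))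
    lower : (z ℤ.< 0ℤ) ⊎ (z ℤ.* z ℤ.< + (4 * p * (d * d))) → LowerCutᵘ (a , p) (mkℚᵘ n dm)
    lower (inj₁ h) = inj₁ (*<* (subst₂ ℤ._<_ (sym numerator≡) refl h))
    lower (inj₂ h) = inj₂ (*<* (subst₂ ℤ._<_ (sym numerator²≡) (sym bound≡) h))

≤ᴿ-by-threshold : ∀ x y → (∀ dm → threshold (suc dm) x ≤ threshold (suc dm) y) → x ≤ᴿ y
≤ᴿ-by-threshold (a , p) (b , q) t≤t r@(mkℚ n dm _) r<x =
  LowerCutᵘ⇒<ˢ r b q (<threshold⇒LowerCutᵘ n dm b q
    (ℤₚ.<-≤-trans (LowerCutᵘ⇒<threshold n dm a p (<ˢ⇒LowerCutᵘ r a p r<x)) (ℤ.+≤+ (t≤t dm))))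

-- The witness is the rational threshold / d, at which the cut of x ends.
<ᴿ-by-threshold : ∀ x y dm → threshold (suc dm) x < threshold (suc dm) y → x <ᴿ y
<ᴿ-by-threshold (a , p) (b , q) dm t<t = r , r∉x , r∈y
  where
  t = threshold (suc dm) (a , p)
  r = fromℚᵘ (mkℚᵘ (+ t) dm)
  r≃ = ℚₚ.toℚᵘ-fromℚᵘ (mkℚᵘ (+ t) dm)
  r∉x : ¬ r <ˢ (a , p)
  r∉x r<x = ℤₚ.<-irrefl refl
    (LowerCutᵘ⇒<threshold (+ t) dm a p (LowerCutᵘ-resp-≃ (a , p) r≃ (<ˢ⇒LowerCutᵘ r a p r<x)))
  r∈y : r <ˢ (b , q)
  r∈y = LowerCutᵘ⇒<ˢ r b q
    (LowerCutᵘ-resp-≃ (b , q) (ℚᵘₚ.≃-sym r≃) (<threshold⇒LowerCutᵘ (+ t) dm b q (+<+ t<t)))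

<ˢ-downward : ∀ x {r s} → r ℚ.≤ s → s <ˢ x → r <ˢ x
<ˢ-downward (a , p) r≤s (inj₁ s-a<0) = inj₁ (ℚₚ.≤-<-trans (ℚₚ.+-monoˡ-≤ (ℚ.- ℕ→ℚ a) r≤s) s-a<0)
<ˢ-downward (a , p) {r} {s} r≤s (inj₂ sq<) = by-sign ((r ℚ.- ℕ→ℚ a) ℚₚ.<? 0ℚ)
  where
  u = r ℚ.- ℕ→ℚ a
  v = s ℚ.- ℕ→ℚ a
  u≤v : u ℚ.≤ v
  u≤v = ℚₚ.+-monoˡ-≤ (ℚ.- ℕ→ℚ a) r≤s
  by-sign : Dec (u ℚ.< 0ℚ) → r <ˢ (a , p)
  by-sign (yes u<0) = inj₁ u<0
  by-sign (no  u≮0) = inj₂ (ℚₚ.≤-<-trans (ℚₚ.≤-trans (ℚₚ.*-monoʳ-≤-nonNeg u u≤v) (ℚₚ.*-monoˡ-≤-nonNeg v u≤v)) sq<)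
    where
    0≤u = ℚₚ.≮⇒≥ u≮0
    instance
      u-nonNeg : ℚ.NonNegative u
      u-nonNeg = ℚ.nonNegative 0≤u
      v-nonNeg : ℚ.NonNegative v
      v-nonNeg = ℚ.nonNegative (ℚₚ.≤-trans 0≤u u≤v)

≤ᴿ-refl : ∀ {x} → x ≤ᴿ x
≤ᴿ-refl _ r<x = r<x

<ᴿ⇒≤ᴿ : ∀ {x y} → x <ᴿ y → x ≤ᴿ y
<ᴿ⇒≤ᴿ {x} {y} (s , s∉x , s∈y) r r∈x = by-order (r ℚₚ.<? s)
  where
  by-order : Dec (r ℚ.< s) → r <ˢ y
  by-order (yes r<s) = <ˢ-downward y (ℚₚ.<⇒≤ r<s) s∈y
  by-order (no  r≮s) = ⊥-elim (s∉x (<ˢ-downward x (ℚₚ.≮⇒≥ r≮s) r∈x))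

<ᴿ⇒≱ᴿ : ∀ {x y} → x <ᴿ y → ¬ y ≤ᴿ x
<ᴿ⇒≱ᴿ (r , r∉x , r∈y) y≤x = r∉x (y≤x r r∈y)

<ᴿ-trans : ∀ {x y z} → x <ᴿ y → y <ᴿ z → x <ᴿ z
<ᴿ-trans {x} {y} x<y (r , r∉y , r∈z) = r , (λ r∈x → r∉y (<ᴿ⇒≤ᴿ {x} {y} x<y r r∈x)) , r∈z

module _ (D P Q e d : ℕ) where
  open ℕₚ.≤-Reasoning

  -- √P ≤ D + √Q, since P ≤ D² + Q + e with e ≤ 2D√Q.
  shifted-square-≤ : P ≤ D * D + Q + e → e * e ≤ 4 * (D * D) * Q →
                     ∀ u → Q * (d * d) ≤ u * u → P * (d * d) ≤ (D * d + u) * (D * d + u)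
  shifted-square-≤ P≤ e²≤ u Qd²≤u² = begin
    P * (d * d)                                    ≤⟨ ℕₚ.*-monoˡ-≤ (d * d) P≤ ⟩
    (D * D + Q + e) * (d * d)                      ≡⟨ solve (D ∷ Q ∷ e ∷ d ∷ []) ⟩
    D * d * (D * d) + Q * (d * d) + e * (d * d)    ≤⟨ ℕₚ.+-mono-≤ (ℕₚ.+-monoʳ-≤ (D * d * (D * d)) Qd²≤u²) ed²≤2Ddu ⟩
    D * d * (D * d) + u * u + 2 * (D * d) * u      ≡⟨ solve (D ∷ d ∷ u ∷ []) ⟩
    (D * d + u) * (D * d + u)                      ∎
    where
    ed²≤2Ddu : e * (d * d) ≤ 2 * (D * d) * u
    ed²≤2Ddu = m*m≤n*n⇒m≤n (begin
      e * (d * d) * (e * (d * d))                  ≡⟨ solve (e ∷ d ∷ []) ⟩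
      e * e * (d * d * (d * d))                    ≤⟨ ℕₚ.*-monoˡ-≤ (d * d * (d * d)) e²≤ ⟩
      4 * (D * D) * Q * (d * d * (d * d))          ≡⟨ solve (D ∷ Q ∷ d ∷ []) ⟩
      2 * (D * d) * (2 * (D * d)) * (Q * (d * d))  ≤⟨ ℕₚ.*-monoʳ-≤ (2 * (D * d) * (2 * (D * d))) Qd²≤u² ⟩
      2 * (D * d) * (2 * (D * d)) * (u * u)        ≡⟨ solve (D ∷ d ∷ u ∷ []) ⟩
      2 * (D * d) * u * (2 * (D * d) * u)          ∎)

  -- D + √Q ≤ √P, since P = D² + Q + e with e > 2D√Q.
  shifted-square-≥ : .{{_ : NonZero d}} → P ≡ D * D + Q + e → 4 * (D * D) * Q < e * e →
                     ∀ w → P * (d * d) ≤ (D * d + w) * (D * d + w) → Q * (d * d) ≤ w * w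
  shifted-square-≥ refl e²> w Pd²≤ = ℕₚ.≮⇒≥ λ w²<Qd² →
    ℕₚ.<-asym e²> (ℕₚ.*-cancelʳ-< (d * d * (d * d)) _ _ (begin-strict
      e * e * (d * d * (d * d))                    ≡⟨ solve (e ∷ d ∷ []) ⟩
      e * (d * d) * (e * (d * d))                  <⟨ ℕₚ.*-mono-< (ed²<2Ddw w²<Qd²) (ed²<2Ddw w²<Qd²) ⟩
      2 * (D * d) * w * (2 * (D * d) * w)          ≡⟨ solve (D ∷ d ∷ w ∷ []) ⟩
      2 * (D * d) * (2 * (D * d)) * (w * w)        ≤⟨ ℕₚ.*-monoʳ-≤ (2 * (D * d) * (2 * (D * d))) (ℕₚ.<⇒≤ w²<Qd²) ⟩
      2 * (D * d) * (2 * (D * d)) * (Q * (d * d))  ≡⟨ solve (D ∷ Q ∷ d ∷ []) ⟩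
      4 * (D * D) * Q * (d * d * (d * d))          ∎))
    where
    ed²<2Ddw : w * w < Q * (d * d) → e * (d * d) < 2 * (D * d) * w
    ed²<2Ddw w²<Qd² = ℕₚ.+-cancelˡ-< (D * d * (D * d) + Q * (d * d)) _ _ (begin-strict
      D * d * (D * d) + Q * (d * d) + e * (d * d)  ≡⟨ solve (D ∷ Q ∷ e ∷ d ∷ []) ⟩
      (D * D + Q + e) * (d * d)                    ≤⟨ Pd²≤ ⟩
      (D * d + w) * (D * d + w)                    ≡⟨ solve (D ∷ d ∷ w ∷ []) ⟩
      D * d * (D * d) + w * w + 2 * (D * d) * w    <⟨ ℕₚ.+-monoˡ-< (2 * (D * d) * w) (ℕₚ.+-monoʳ-< (D * d * (D * d)) w²<Qd²) ⟩
      D * d * (D * d) + Q * (d * d) + 2 * (D * d) * w ∎)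

  shifted-ceilSqrt-≤ : P ≤ D * D + Q + e → e * e ≤ 4 * (D * D) * Q →
                       ceilSqrt (P * (d * d)) ≤ D * d + ceilSqrt (Q * (d * d))
  shifted-ceilSqrt-≤ P≤ e²≤ = ceilSqrt-least _ (shifted-square-≤ P≤ e²≤ _ (≤-ceilSqrt² _))

  shifted-ceilSqrt-≥ : .{{_ : NonZero d}} → P ≡ D * D + Q + e → 4 * (D * D) * Q < e * e →
                       D * d + ceilSqrt (Q * (d * d)) ≤ ceilSqrt (P * (d * d))
  shifted-ceilSqrt-≥ P≡ e²> = begin
    D * d + ceilSqrt (Q * (d * d)) ≤⟨ ℕₚ.+-monoʳ-≤ (D * d) (ceilSqrt-least _ Qd²≤w²) ⟩
    D * d + w                      ≡⟨ v≡ ⟩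
    v                              ∎
    where
    v = ceilSqrt (P * (d * d))
    Dd≤v : D * d ≤ v
    Dd≤v = m*m≤n*n⇒m≤n (begin
      D * d * (D * d) ≡⟨ solve (D ∷ d ∷ []) ⟩
      D * D * (d * d) ≤⟨ ℕₚ.*-monoˡ-≤ (d * d) (subst (D * D ≤_) (sym P≡) (ℕₚ.≤-trans (ℕₚ.m≤m+n (D * D) Q) (ℕₚ.m≤m+n _ e))) ⟩
      P * (d * d)     ≤⟨ ≤-ceilSqrt² _ ⟩
      v * v           ∎)
    w = v ∸ D * d
    v≡ : D * d + w ≡ v
    v≡ = ℕₚ.m+[n∸m]≡n Dd≤v
    Qd²≤w² : Q * (d * d) ≤ w * w
    Qd²≤w² = shifted-square-≥ P≡ e²> w (subst (λ t → P * (d * d) ≤ t * t) (sym v≡) (≤-ceilSqrt² _))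

threshold-shift : ∀ a D q d → threshold d (a + D , q) ≡ a * d + (D * d + ceilSqrt (4 * q * (d * d)))
threshold-shift a D q d = shift (ceilSqrt (4 * q * (d * d)))
  where shift : ∀ c → (a + D) * d + c ≡ a * d + (D * d + c)
        shift c = solve (a ∷ D ∷ d ∷ c ∷ [])

≤ᴿ-total-shift : ∀ a D p q → (a , p) ≤ᴿ (a + D , q) ⊎ (a + D , q) ≤ᴿ (a , p)
≤ᴿ-total-shift a D p q = compare (e * e ≤? 4 * (D * D) * (4 * q))
  where
  x = (a , p)
  y = (a + D , q)
  e = 4 * p ∸ (D * D + 4 * q)
  compare : Dec (e * e ≤ 4 * (D * D) * (4 * q)) → x ≤ᴿ y ⊎ y ≤ᴿ x
  compare (yes e²≤) = inj₁ (≤ᴿ-by-threshold x y λ dm →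
    subst (threshold (suc dm) x ≤_) (sym (threshold-shift a D q (suc dm)))
      (ℕₚ.+-monoʳ-≤ (a * suc dm) (shifted-ceilSqrt-≤ D (4 * p) (4 * q) e (suc dm) (ℕₚ.m≤n+m∸n (4 * p) (D * D + 4 * q)) e²≤)))
  compare (no e²≰) = inj₂ (≤ᴿ-by-threshold y x λ dm →
    subst (_≤ threshold (suc dm) x) (sym (threshold-shift a D q (suc dm)))
      (ℕₚ.+-monoʳ-≤ (a * suc dm) (shifted-ceilSqrt-≥ D (4 * p) (4 * q) e (suc dm) (sym (ℕₚ.m+[n∸m]≡n Q<P)) e²>)))
    where
    e²> = ℕₚ.≰⇒> e²≰
    Q<P : D * D + 4 * q ≤ 4 * p
    Q<P = ℕₚ.≮⇒≥ λ P<Q → ℕₚ.<-irrefl refl (ℕₚ.<-≤-trans e²>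
      (subst (λ t → t * t ≤ 4 * (D * D) * (4 * q)) (sym (ℕₚ.m≤n⇒m∸n≡0 (ℕₚ.<⇒≤ P<Q))) z≤n))

≤ᴿ-total-≤ : ∀ a b p q → a ≤ b → (a , p) ≤ᴿ (b , q) ⊎ (b , q) ≤ᴿ (a , p)
≤ᴿ-total-≤ a b p q a≤b =
  subst (λ c → (a , p) ≤ᴿ (c , q) ⊎ (c , q) ≤ᴿ (a , p)) (ℕₚ.m+[n∸m]≡n a≤b) (≤ᴿ-total-shift a (b ∸ a) p q)

≤ᴿ-total : ∀ x y → x ≤ᴿ y ⊎ y ≤ᴿ x
≤ᴿ-total (a , p) (b , q) = [ ≤ᴿ-total-≤ a b p q , swap ∘ ≤ᴿ-total-≤ b a q p ]′ (ℕₚ.≤-total a b)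

module _ (b C dm : ℕ) where
  open ℕₚ.≤-Reasoning

  -- Moving a unit from β to α raises 𝔑: the gain is 1, the loss 2√((b+1)C) − 2√(bC) < √(C/b) ≤ 1.
  β→α-square : C ≤ b → 4 * C * suc dm ≤ dm * dm →
               ∀ u → 4 * (b * C) * (suc dm * suc dm) ≤ u * u →
               4 * (suc b * C) * (suc dm * suc dm) ≤ (u + dm) * (u + dm)
  β→α-square C≤b gap u X≤u² = begin
    4 * (suc b * C) * (suc dm * suc dm)                                  ≡⟨ solve (b ∷ C ∷ dm ∷ []) ⟩
    4 * (b * C) * (suc dm * suc dm) + 2 * (2 * C * suc dm) * dm + 4 * C * suc dm
      ≤⟨ ℕₚ.+-mono-≤ (ℕₚ.+-mono-≤ X≤u² (ℕₚ.*-monoˡ-≤ dm (ℕₚ.*-monoʳ-≤ 2 2Cd≤u))) gap ⟩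
    u * u + 2 * u * dm + dm * dm                                         ≡⟨ solve (u ∷ dm ∷ []) ⟩
    (u + dm) * (u + dm)                                                  ∎
    where
    2Cd≤u : 2 * C * suc dm ≤ u
    2Cd≤u = m*m≤n*n⇒m≤n (begin
      2 * C * suc dm * (2 * C * suc dm)   ≡⟨ solve (C ∷ dm ∷ []) ⟩
      4 * (C * C) * (suc dm * suc dm)     ≤⟨ ℕₚ.*-monoˡ-≤ (suc dm * suc dm) (ℕₚ.*-monoʳ-≤ 4 (ℕₚ.*-monoˡ-≤ C C≤b)) ⟩
      4 * (b * C) * (suc dm * suc dm)     ≤⟨ X≤u² ⟩
      u * u                               ∎)

β→α-< : ∀ α b C → C ≤ b → (α , suc b * C) <ᴿ (suc α , b * C)
β→α-< α b C C≤b = <ᴿ-by-threshold (α , suc b * C) (suc α , b * C) dm (begin-strict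
    α * d + ceilSqrt (4 * (suc b * C) * (d * d)) ≤⟨ ℕₚ.+-monoʳ-≤ (α * d) (ceilSqrt-least _ (β→α-square b C dm C≤b gap u (≤-ceilSqrt² _))) ⟩
    α * d + (u + dm)                             <⟨ ℕₚ.≤-reflexive (rearrange u) ⟩
    suc α * d + u                                ∎)
  where
  open ℕₚ.≤-Reasoning
  dm = 4 * C + 1
  d = suc dm
  u = ceilSqrt (4 * (b * C) * (d * d))
  gap : 4 * C * suc dm ≤ dm * dm
  gap = ℕₚ.≤-trans (ℕₚ.m≤m+n _ 1) (ℕₚ.≤-reflexive (square C))
    where square : ∀ C → 4 * C * suc (4 * C + 1) + 1 ≡ (4 * C + 1) * (4 * C + 1)
          square C = solve (C ∷ [])
  rearrange : ∀ x → suc (α * d + (x + dm)) ≡ suc α * d + x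
  rearrange x = arith α C x
    where arith : ∀ α C x → suc (α * suc (4 * C + 1) + (x + (4 * C + 1))) ≡ suc α * suc (4 * C + 1) + x
          arith α C x = solve (α ∷ C ∷ x ∷ [])

module _ (B₀ C d : ℕ) .{{_ : NonZero d}} where
  open ℕₚ.≤-Reasoning

  -- Moving a unit from α to γ raises 𝔑: the loss is 1, the gain 2√(B(C+1)) − 2√(BC) > √(B/(C+1)) ≥ 1.
  α→γ-square : C ≤ B₀ → 4 * B₀ + 2 ≤ d →
               ∀ t → t * t ≤ 4 * (suc B₀ * C) * (d * d) →
               (d + suc t) * (d + suc t) < 4 * (suc B₀ * suc C) * (d * d)
  α→γ-square C≤B₀ gap t t²≤ = begin-strict
    (d + suc t) * (d + suc t)                                   ≡⟨ solve (d ∷ t ∷ []) ⟩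
    t * t + (2 * (d + 1) * t + (d + 1) * (d + 1))              <⟨ ℕₚ.+-mono-≤-< t²≤ rest< ⟩
    4 * (suc B₀ * C) * (d * d) + 4 * suc B₀ * (d * d)          ≡⟨ solve (B₀ ∷ C ∷ d ∷ []) ⟩
    4 * (suc B₀ * suc C) * (d * d)                             ∎
    where
    t<[2B₀+1]d : t < (2 * B₀ + 1) * d
    t<[2B₀+1]d = m*m<n*n⇒m<n (begin-strict
      t * t                                                    ≤⟨ t²≤ ⟩
      4 * (suc B₀ * C) * (d * d)                               ≤⟨ ℕₚ.*-monoˡ-≤ (d * d) (ℕₚ.*-monoʳ-≤ 4 (ℕₚ.*-monoʳ-≤ (suc B₀) C≤B₀)) ⟩
      4 * (suc B₀ * B₀) * (d * d)                              <⟨ ℕₚ.m<m+n _ (ℕ.>-nonZero⁻¹ (d * d) {{ℕₚ.m*n≢0 d d}}) ⟩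
      4 * (suc B₀ * B₀) * (d * d) + d * d                      ≡⟨ solve (B₀ ∷ d ∷ []) ⟩
      (2 * B₀ + 1) * d * ((2 * B₀ + 1) * d)                    ∎)
    rest< : 2 * (d + 1) * t + (d + 1) * (d + 1) < 4 * suc B₀ * (d * d)
    rest< = ℕₚ.+-cancelʳ-≤ (2 * (d + 1)) _ _ (begin
      suc (2 * (d + 1) * t + (d + 1) * (d + 1)) + 2 * (d + 1)  ≡⟨ solve (d ∷ t ∷ []) ⟩
      2 * (d + 1) * suc t + (d + 1) * (d + 1) + 1              ≤⟨ ℕₚ.+-monoˡ-≤ 1 (ℕₚ.+-monoˡ-≤ ((d + 1) * (d + 1)) (ℕₚ.*-monoʳ-≤ (2 * (d + 1)) t<[2B₀+1]d)) ⟩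
      2 * (d + 1) * ((2 * B₀ + 1) * d) + (d + 1) * (d + 1) + 1 ≡⟨ solve (B₀ ∷ d ∷ []) ⟩
      (4 * B₀ + 2) * d + (4 * B₀ + 2) * (d * d) + (d * d + 2 * (d + 1))
        ≤⟨ ℕₚ.+-monoˡ-≤ (d * d + 2 * (d + 1)) (ℕₚ.+-monoˡ-≤ ((4 * B₀ + 2) * (d * d)) (ℕₚ.*-monoˡ-≤ d gap)) ⟩
      d * d + (4 * B₀ + 2) * (d * d) + (d * d + 2 * (d + 1))   ≡⟨ solve (B₀ ∷ d ∷ []) ⟩
      4 * suc B₀ * (d * d) + 2 * (d + 1)                       ∎)

α→γ-< : ∀ α B₀ C → C ≤ B₀ → (suc α , suc B₀ * C) <ᴿ (α , suc B₀ * suc C)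
α→γ-< α B₀ C C≤B₀ = <ᴿ-by-threshold (suc α , suc B₀ * C) (α , suc B₀ * suc C) dm (begin-strict
    suc α * d + s               ≡⟨ rearrange s ⟩
    α * d + (d + s)             <⟨ ℕₚ.+-monoʳ-< (α * d) (²<⇒<ceilSqrt (begin-strict
      (d + s) * (d + s)         ≤⟨ ℕₚ.*-mono-≤ d+s≤ d+s≤ ⟩
      (d + suc t) * (d + suc t) <⟨ α→γ-square B₀ C d C≤B₀ gap t t²≤ ⟩
      4 * (suc B₀ * suc C) * (d * d) ∎)) ⟩
    α * d + ceilSqrt (4 * (suc B₀ * suc C) * (d * d)) ∎)
  where
  open ℕₚ.≤-Reasoning
  dm = 4 * B₀ + 1
  d = suc dm
  s = ceilSqrt (4 * (suc B₀ * C) * (d * d))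
  t = proj₁ (ceilSqrt-pred (4 * (suc B₀ * C) * (d * d)))
  t²≤ : t * t ≤ 4 * (suc B₀ * C) * (d * d)
  t²≤ = proj₂ (proj₂ (ceilSqrt-pred (4 * (suc B₀ * C) * (d * d))))
  d+s≤ : d + s ≤ d + suc t
  d+s≤ = ℕₚ.+-monoʳ-≤ d (proj₁ (proj₂ (ceilSqrt-pred (4 * (suc B₀ * C) * (d * d)))))
  gap : 4 * B₀ + 2 ≤ d
  gap = ℕₚ.≤-reflexive (arith B₀)
    where arith : ∀ B₀ → 4 * B₀ + 2 ≡ suc (4 * B₀ + 1)
          arith B₀ = solve (B₀ ∷ [])
  rearrange : ∀ x → suc α * d + x ≡ α * d + (d + x)
  rearrange x = arith α B₀ x
    where arith : ∀ α B₀ x → suc α * suc (4 * B₀ + 1) + x ≡ α * suc (4 * B₀ + 1) + (suc (4 * B₀ + 1) + x)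
          arith α B₀ x = solve (α ∷ B₀ ∷ x ∷ [])

β→α-<* : ∀ j α B C → C ≤ B → (α , (suc j + B) * C) <ᴿ (suc j + α , B * C)
β→α-<* zero    α B C C≤B = β→α-< α B C C≤B
β→α-<* (suc j) α B C C≤B =
  <ᴿ-trans {α , (suc (suc j) + B) * C} {suc α , (suc j + B) * C} {suc (suc j) + α , B * C}
    (β→α-< α (suc j + B) C (ℕₚ.≤-trans C≤B (ℕₚ.m≤n+m B (suc j))))
    (subst (λ a → (suc α , (suc j + B) * C) <ᴿ (a , B * C)) (ℕₚ.+-suc (suc j) α) (β→α-<* j (suc α) B C C≤B))

α→γ-<* : ∀ k α B₀ C → k + C ≤ B₀ → (suc k + α , suc B₀ * C) <ᴿ (α , suc B₀ * (suc k + C))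
α→γ-<* zero    α B₀ C C≤B₀ = α→γ-< α B₀ C C≤B₀
α→γ-<* (suc k) α B₀ C k+C<B₀ =
  <ᴿ-trans {suc (suc k) + α , suc B₀ * C} {suc k + α , suc B₀ * suc C} {α , suc B₀ * (suc (suc k) + C)}
    (α→γ-< (suc k + α) B₀ C (ℕₚ.m+n≤o⇒n≤o (suc k) k+C<B₀))
    (subst (λ c → (suc k + α , suc B₀ * suc C) <ᴿ (α , suc B₀ * c)) (ℕₚ.+-suc (suc k) C)
      (α→γ-<* k α B₀ (suc C) (subst (_≤ B₀) (sym (ℕₚ.+-suc k C)) k+C<B₀)))

weight : Triple → ℕ
weight t = γ_ t + α_ t + β_ t

∃-offset : ∀ {m n} → m ≤ n → Σ ℕ λ k → n ≡ k + m
∃-offset {m} m≤n with ℕₚ.m≤n⇒∃[o]m+o≡n m≤n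
... | k , m+k≡n = k , trans (sym m+k≡n) (ℕₚ.+-comm m k)

𝔑-<-by-offsets : ∀ {γ₁ α₁ α₂ β₂} j k → k + γ₁ ≤ β₂ → j + α₁ ≡ k + α₂ →
                 (γ₁ , α₁ , j + β₂) ≢ (k + γ₁ , α₂ , β₂) → (α₁ , (j + β₂) * γ₁) <ᴿ (α₂ , β₂ * (k + γ₁))
𝔑-<-by-offsets {γ₁} {α₁} {α₂} {β₂} zero zero _ α₁≡α₂ t₁≢t₂ = ⊥-elim (t₁≢t₂ (cong (λ α → γ₁ , α , β₂) α₁≡α₂))
𝔑-<-by-offsets {γ₁} {α₁} {α₂} {β₂} (suc j) zero γ₁≤β₂ α≡ _ =
  subst (λ α → (α₁ , (suc j + β₂) * γ₁) <ᴿ (α , β₂ * γ₁)) α≡ (β→α-<* j α₁ β₂ γ₁ γ₁≤β₂)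
𝔑-<-by-offsets {γ₁} {α₁} {α₂} {suc B₀} zero (suc k) (s≤s k+γ₁≤B₀) α≡ _ =
  subst (λ α → (α , suc B₀ * γ₁) <ᴿ (α₂ , suc B₀ * (suc k + γ₁))) (sym α≡) (α→γ-<* k α₂ B₀ γ₁ k+γ₁≤B₀)
𝔑-<-by-offsets {γ₁} {α₁} {α₂} {suc B₀} (suc j) (suc k) (s≤s k+γ₁≤B₀) α≡ _ =
  <ᴿ-trans {α₁ , (suc j + suc B₀) * γ₁} {suc j + α₁ , suc B₀ * γ₁} {α₂ , suc B₀ * (suc k + γ₁)}
    (β→α-<* j α₁ (suc B₀) γ₁ (ℕₚ.≤-trans (ℕₚ.m≤n+m γ₁ k) (ℕₚ.m≤n⇒m≤1+n k+γ₁≤B₀)))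
    (subst (λ α → (α , suc B₀ * γ₁) <ᴿ (α₂ , suc B₀ * (suc k + γ₁))) (sym α≡) (α→γ-<* k α₂ B₀ γ₁ k+γ₁≤B₀))

-- Within the half γ ≤ β, 𝔑 = κ − (√β − √γ)² grows as β and γ approach each other.
𝔑-<-upper : ∀ t₁ t₂ → γ_ t₁ ≤ γ_ t₂ → γ_ t₂ ≤ β_ t₂ → β_ t₂ ≤ β_ t₁ → weight t₁ ≡ weight t₂ → t₁ ≢ t₂ →
            𝔑 t₁ <ᴿ 𝔑 t₂
𝔑-<-upper (γ₁ , α₁ , β₁) (γ₂ , α₂ , β₂) γ₁≤γ₂ γ₂≤β₂ β₂≤β₁ =
  by-offsets (∃-offset β₂≤β₁) (∃-offset γ₁≤γ₂) γ₂≤β₂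
  where
  by-offsets : ∀ {β₁ γ₂} → Σ ℕ (λ j → β₁ ≡ j + β₂) → Σ ℕ (λ k → γ₂ ≡ k + γ₁) → γ₂ ≤ β₂ →
               γ₁ + α₁ + β₁ ≡ γ₂ + α₂ + β₂ → (γ₁ , α₁ , β₁) ≢ (γ₂ , α₂ , β₂) → (α₁ , β₁ * γ₁) <ᴿ (α₂ , β₂ * γ₂)
  by-offsets (j , refl) (k , refl) k+γ₁≤β₂ w≡ = 𝔑-<-by-offsets j k k+γ₁≤β₂
    (ℕₚ.+-cancelʳ-≡ (γ₁ + β₂) _ _ (trans (sym (regroup γ₁ α₁ j β₂)) (trans w≡ (regroup′ k γ₁ α₂ β₂))))
    where
    regroup : ∀ γ α j β → γ + α + (j + β) ≡ j + α + (γ + β)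
    regroup γ α j β = solve (γ ∷ α ∷ j ∷ β ∷ [])
    regroup′ : ∀ k γ α β → k + γ + α + β ≡ k + α + (γ + β)
    regroup′ k γ α β = solve (k ∷ γ ∷ α ∷ β ∷ [])

mirror : Triple → Triple
mirror (γ , α , β) = (β , α , γ)

𝔑-mirror : ∀ t → 𝔑 (mirror t) ≡ 𝔑 t
𝔑-mirror (γ , α , β) = cong (α ,_) (ℕₚ.*-comm γ β)

𝔑-<-lower : ∀ t₁ t₂ → β_ t₁ ≤ β_ t₂ → β_ t₂ ≤ γ_ t₂ → γ_ t₂ ≤ γ_ t₁ → weight t₁ ≡ weight t₂ → t₁ ≢ t₂ →
            𝔑 t₁ <ᴿ 𝔑 t₂
𝔑-<-lower t₁@(γ₁ , α₁ , β₁) t₂@(γ₂ , α₂ , β₂) β₁≤β₂ β₂≤γ₂ γ₂≤γ₁ w≡ t₁≢t₂ =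
  subst₂ _<ᴿ_ (𝔑-mirror t₁) (𝔑-mirror t₂)
    (𝔑-<-upper (mirror t₁) (mirror t₂) β₁≤β₂ β₂≤γ₂ γ₂≤γ₁ (trans (reverse γ₁ α₁ β₁) (trans w≡ (sym (reverse γ₂ α₂ β₂))))
      λ { refl → t₁≢t₂ refl })
  where
  reverse : ∀ γ α β → β + α + γ ≡ γ + α + β
  reverse γ α β = solve (γ ∷ α ∷ β ∷ [])

module Unimodality {a ℓ} {A : Set a} (_≼_ : A → A → Set ℓ) (≼-total : ∀ x y → x ≼ y ⊎ y ≼ x)
                   (f : ℕ → A) (P : ℕ → Set) (P? : ∀ i → Dec (P i)) (n : ℕ)
                   (P-downward : ∀ i → 1 ≤ i → i + 1 ≤ n → P (i + 1) → P i)
                   (rise : ∀ i → 1 ≤ i → i + 1 ≤ n → P (i + 1) → f i ≼ f (i + 1))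
                   (fall : ∀ i → 1 ≤ i → i + 1 ≤ n → ¬ P i → f (i + 1) ≼ f i) where

  RisesBelow : ℕ → Set ℓ
  RisesBelow t = ∀ i → 1 ≤ i → i < t → f i ≼ f (i + 1)

  FallsBetween : ℕ → ℕ → Set ℓ
  FallsBetween t e = ∀ i → t ≤ i → i < e → f (i + 1) ≼ f i

  Unimodal : ℕ → Set ℓ
  Unimodal e = Σ ℕ λ t → (1 ≤ t) × (t ≤ e) × RisesBelow t × FallsBetween t e

  -- Strengthened so that the peak can move to the new end while P still holds there.
  unimodal-upTo : ∀ m → suc m ≤ n → Unimodal (suc m) × (P (suc m) → RisesBelow (suc m))
  unimodal-upTo zero _ = (1 , ℕₚ.≤-refl , ℕₚ.≤-refl , rises-below-1 , falls-at-1) , λ _ → rises-below-1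
    where
    rises-below-1 : RisesBelow 1
    rises-below-1 i 1≤i i<1 = ⊥-elim (ℕₚ.<⇒≱ i<1 1≤i)
    falls-at-1 : FallsBetween 1 1
    falls-at-1 i 1≤i i<1 = ⊥-elim (ℕₚ.<⇒≱ i<1 1≤i)
  unimodal-upTo (suc m) e<n with unimodal-upTo m (ℕₚ.<⇒≤ e<n)
  ... | (t , 1≤t , t≤e , rises , falls) , rises-if-P = extend (P? e) (P? e′)
    where
    e = suc m
    e′ = suc (suc m)
    e+1≡e′ : e + 1 ≡ e′
    e+1≡e′ = ℕₚ.+-comm e 1
    1≤e : 1 ≤ e
    1≤e = s≤s z≤n
    e+1≤n : e + 1 ≤ n
    e+1≤n = subst (_≤ n) (sym e+1≡e′) e<n
    below-e′ : ∀ {i} → i < e′ → (i < e) ⊎ (i ≡ e)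
    below-e′ i<e′ = ℕₚ.m≤n⇒m<n∨m≡n (ℕₚ.≤-pred i<e′)
    rises-to : P e → f e ≼ f (e + 1) → RisesBelow e′
    rises-to Pe up i 1≤i i<e′ with below-e′ i<e′
    ... | inj₁ i<e  = rises-if-P Pe i 1≤i i<e
    ... | inj₂ refl = up
    no-fall : FallsBetween e′ e′
    no-fall i e′≤i i<e′ = ⊥-elim (ℕₚ.<⇒≱ i<e′ e′≤i)
    extend : Dec (P e) → Dec (P e′) → Unimodal e′ × (P e′ → RisesBelow e′)
    extend _ (yes Pe′) = (e′ , s≤s z≤n , ℕₚ.≤-refl , rises-to Pe up , no-fall) , λ _ → rises-to Pe up
      where
      Pe = P-downward e 1≤e e+1≤n (subst P (sym e+1≡e′) Pe′)
      up = rise e 1≤e e+1≤n (subst P (sym e+1≡e′) Pe′)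
    extend (no ¬Pe) (no ¬Pe′) = (t , 1≤t , ℕₚ.m≤n⇒m≤1+n t≤e , rises , falls′) , λ Pe′ → ⊥-elim (¬Pe′ Pe′)
      where
      falls′ : FallsBetween t e′
      falls′ i t≤i i<e′ with below-e′ i<e′
      ... | inj₁ i<e  = falls i t≤i i<e
      ... | inj₂ refl = fall e 1≤e e+1≤n ¬Pe
    extend (yes Pe) (no ¬Pe′) with ≼-total (f e) (f (e + 1))
    ... | inj₁ up   = (e′ , s≤s z≤n , ℕₚ.≤-refl , rises-to Pe up , no-fall) , λ Pe′ → ⊥-elim (¬Pe′ Pe′)
    ... | inj₂ down = (e , 1≤e , ℕₚ.n≤1+n e , rises-if-P Pe , falls-from-e) , λ Pe′ → ⊥-elim (¬Pe′ Pe′)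
      where
      falls-from-e : FallsBetween e e′
      falls-from-e i e≤i i<e′ with below-e′ i<e′
      ... | inj₁ i<e  = ⊥-elim (ℕₚ.<⇒≱ i<e e≤i)
      ... | inj₂ refl = down

  unimodal : 1 ≤ n → Unimodal n
  unimodal (s≤s {n = m} _) = proj₁ (unimodal-upTo m ℕₚ.≤-refl)

_≟ₜ_ : (s t : Triple) → Dec (s ≡ t)
_≟ₜ_ = ≡-dec ℕ._≟_ (≡-dec ℕ._≟_ ℕ._≟_)

InV⇒weight : ∀ {κ λ'} t → InV κ λ' t → weight t ≡ κ
InV⇒weight (γ , α , β) (_ , _ , w≡κ , _) = w≡κ

module MinimumOverV {κ λ' : ℕ} (λ'+2≤κ : λ' + 2 ≤ κ) where

  K : ℕ
  K = κ ∸ λ' ∸ 1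

  λ'+1≤κ : λ' + 1 ≤ κ
  λ'+1≤κ = ℕₚ.≤-trans (ℕₚ.+-monoʳ-≤ λ' (s≤s z≤n)) λ'+2≤κ

  K≡ : K ≡ κ ∸ (λ' + 1)
  K≡ = ℕₚ.∸-+-assoc κ λ' 1

  1≤K : 1 ≤ K
  1≤K = subst (1 ≤_) (sym K≡) (ℕₚ.m+n≤o⇒m≤o∸n 1 (subst (_≤ κ) (regroup λ') λ'+2≤κ))
    where regroup : ∀ l → l + 2 ≡ 1 + (l + 1)
          regroup l = solve (l ∷ [])

  weight-start : 1 + λ' + K ≡ κ
  weight-start = trans (cong (_+ K) (ℕₚ.+-comm 1 λ')) (trans (cong (λ k → λ' + 1 + k) K≡) (ℕₚ.m+[n∸m]≡n λ'+1≤κ))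

  -- This is where the lower bound on α in V_{κ,λ} enters.
  InV⇒≤K : ∀ {x y z} → x + y + z ≡ κ → (λ' + 1) ∸ x ≤ y → z ≤ K
  InV⇒≤K {x} {y} {z} w≡κ α≥ = subst (z ≤_) (sym K≡) (ℕₚ.m+n≤o⇒m≤o∸n z (begin
    z + (λ' + 1)  ≤⟨ ℕₚ.+-monoʳ-≤ z (ℕₚ.≤-trans (ℕₚ.m≤n+m∸n (λ' + 1) x) (ℕₚ.+-monoʳ-≤ x α≥)) ⟩
    z + (x + y)   ≡⟨ solve (x ∷ y ∷ z ∷ []) ⟩
    x + y + z     ≡⟨ w≡κ ⟩
    κ             ∎))
    where open ℕₚ.≤-Reasoning

  Extremal : Triple → Set
  Extremal t = (t ≡ (1 , λ' , K)) ⊎ (t ≡ (K , λ' , 1))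

  Extremal? : ∀ t → Dec (Extremal t)
  Extremal? t = (t ≟ₜ (1 , λ' , K)) ⊎-dec (t ≟ₜ (K , λ' , 1))

  𝔑-extremal : ∀ {t} → Extremal t → 𝔑 t ≈ᴿ 𝔑 (1 , λ' , K)
  𝔑-extremal (inj₁ refl) = ≤ᴿ-refl {𝔑 (1 , λ' , K)} , ≤ᴿ-refl {𝔑 (1 , λ' , K)}
  𝔑-extremal (inj₂ refl) = subst (λ x → x ≈ᴿ 𝔑 (1 , λ' , K)) (sym (𝔑-mirror (1 , λ' , K)))
                                  (≤ᴿ-refl {𝔑 (1 , λ' , K)} , ≤ᴿ-refl {𝔑 (1 , λ' , K)})

  𝔑-nonextremal : ∀ t → InV κ λ' t → ¬ Extremal t → 𝔑 (1 , λ' , K) <ᴿ 𝔑 t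
  𝔑-nonextremal t@(γ , α , β) (1≤β , 1≤γ , w≡κ , α≥β , α≥γ) ¬ext = by-half (γ ≤? β)
    where
    reorder : ∀ γ α β → β + α + γ ≡ γ + α + β
    reorder γ α β = solve (γ ∷ α ∷ β ∷ [])
    reverse : ∀ k l → k + l + 1 ≡ 1 + l + k
    reverse k l = solve (k ∷ l ∷ [])
    by-half : Dec (γ ≤ β) → 𝔑 (1 , λ' , K) <ᴿ 𝔑 t
    by-half (yes γ≤β) = 𝔑-<-upper (1 , λ' , K) t 1≤γ γ≤β (InV⇒≤K w≡κ α≥γ) (trans weight-start (sym w≡κ))
                    λ t≡ → ¬ext (inj₁ (sym t≡))
    by-half (no  γ≰β) = subst (_<ᴿ 𝔑 t) (𝔑-mirror (1 , λ' , K))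
                    (𝔑-<-lower (K , λ' , 1) t 1≤β (ℕₚ.<⇒≤ (ℕₚ.≰⇒> γ≰β)) (InV⇒≤K (trans (reorder γ α β) w≡κ) α≥β)
                      (trans (trans (reverse K λ') weight-start) (sym w≡κ)) λ t≡ → ¬ext (inj₂ (sym t≡)))

  𝔑-minimum : ∀ t → InV κ λ' t →
              (𝔑 (1 , λ' , K) ≤ᴿ 𝔑 t) × ((𝔑 t ≈ᴿ 𝔑 (1 , λ' , K) → Extremal t) × (Extremal t → 𝔑 t ≈ᴿ 𝔑 (1 , λ' , K)))
  𝔑-minimum t t∈V = by-cases (Extremal? t)
    where
    start = 𝔑 (1 , λ' , K)
    by-cases : Dec (Extremal t) → (start ≤ᴿ 𝔑 t) × ((𝔑 t ≈ᴿ start → Extremal t) × (Extremal t → 𝔑 t ≈ᴿ start))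
    by-cases (yes ext) = proj₂ (𝔑-extremal ext) , (λ _ → ext) , 𝔑-extremal
    by-cases (no ¬ext) = <ᴿ⇒≤ᴿ {start} {𝔑 t} start<t ,
                         (λ t≈ → ⊥-elim (<ᴿ⇒≱ᴿ {start} {𝔑 t} start<t (proj₁ t≈))) ,
                         (λ ext → ⊥-elim (¬ext ext))
      where start<t = 𝔑-nonextremal t t∈V ¬ext

module GraphicalSequence {κ λ' g G} (𝒢 : Graphical κ λ' g G) (λ'+2≤κ : λ' + 2 ≤ κ) where
  open Graphical 𝒢
  open MinimumOverV λ'+2≤κ

  R : ℕ → Surd
  R i = 𝔑 (G i)

  Upper : ℕ → Set
  Upper i = γ_ (G i) ≤ β_ (G i)

  private
    ≤g⇒≤g+1 : ∀ {i} → i ≤ g → i ≤ g + 1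
    ≤g⇒≤g+1 i≤g = ℕₚ.≤-trans i≤g (ℕₚ.m≤m+n g 1)

    +1≤⇒≤∸1 : ∀ {i} → i + 1 ≤ g → i ≤ g ∸ 1
    +1≤⇒≤∸1 {i} i+1≤g = subst (_≤ g ∸ 1) (ℕₚ.m+n∸n≡m i 1) (ℕₚ.∸-monoˡ-≤ 1 i+1≤g)

    i≢i+1 : ∀ i → i ≢ i + 1
    i≢i+1 i i≡ = ℕₚ.<-irrefl (trans i≡ (ℕₚ.+-comm i 1)) ℕₚ.≤-refl

    +1≤⇒≤ : ∀ {i} → i + 1 ≤ g → i ≤ g
    +1≤⇒≤ {i} i+1≤g = ℕₚ.≤-trans (ℕₚ.m≤m+n i 1) i+1≤g

    weight-step : ∀ {i} → 1 ≤ i → i + 1 ≤ g → weight (G i) ≡ weight (G (i + 1))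
    weight-step {i} 1≤i i+1≤g = trans (InV⇒weight (G i) (G0 i 1≤i (+1≤⇒≤ i+1≤g)))
                                      (sym (InV⇒weight (G (i + 1)) (G0 (i + 1) (ℕₚ.m≤n+m 1 i) i+1≤g)))

    distinct-step : ∀ {i} → 1 ≤ i → i + 1 ≤ g → G i ≢ G (i + 1)
    distinct-step {i} 1≤i i+1≤g =
      distinct i (i + 1) 1≤i (≤g⇒≤g+1 (+1≤⇒≤ i+1≤g)) (ℕₚ.m≤n+m 1 i) (≤g⇒≤g+1 i+1≤g) (i≢i+1 i)

  rises : ∀ i → 1 ≤ i → i + 1 ≤ g → Upper (i + 1) → R i <ᴿ R (i + 1)
  rises i 1≤i i+1≤g upper = 𝔑-<-upper (G i) (G (i + 1)) (G2γ i 1≤i (+1≤⇒≤ i+1≤g)) upper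
    (G2β i 1≤i (+1≤⇒≤∸1 i+1≤g)) (weight-step 1≤i i+1≤g) (distinct-step 1≤i i+1≤g)

  falls : ∀ i → 1 ≤ i → i + 1 ≤ g → β_ (G i) ≤ γ_ (G i) → R (i + 1) <ᴿ R i
  falls i 1≤i i+1≤g lower = 𝔑-<-lower (G (i + 1)) (G i) (G2β i 1≤i (+1≤⇒≤∸1 i+1≤g)) lower
    (G2γ i 1≤i (+1≤⇒≤ i+1≤g)) (sym (weight-step 1≤i i+1≤g)) (λ e → distinct-step 1≤i i+1≤g (sym e))

  Upper-downward : ∀ i → 1 ≤ i → i + 1 ≤ g → Upper (i + 1) → Upper i
  Upper-downward i 1≤i i+1≤g upper =
    ℕₚ.≤-trans (G2γ i 1≤i (+1≤⇒≤ i+1≤g)) (ℕₚ.≤-trans upper (G2β i 1≤i (+1≤⇒≤∸1 i+1≤g)))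

  1≤g : 1 ≤ g
  1≤g = ℕₚ.n≢0⇒n>0 λ g≡0 → ℕₚ.<⇒≢ 1≤K (sym (trans (sym (cong β_ G1)) (subst (λ n → β_ (G (n + 1)) ≡ 0) g≡0 (proj₁ G3))))

  R-minimum : ∀ i → 1 ≤ i → i ≤ g →
            (𝔑 (G 1) ≤ᴿ R i) × ((R i ≈ᴿ 𝔑 (G 1) → Extremal (G i)) × (Extremal (G i) → R i ≈ᴿ 𝔑 (G 1)))
  R-minimum i 1≤i i≤g = subst (λ s → (𝔑 s ≤ᴿ R i) × ((R i ≈ᴿ 𝔑 s → Extremal (G i)) × (Extremal (G i) → R i ≈ᴿ 𝔑 s)))
    (sym G1) (𝔑-minimum (G i) (G0 i 1≤i i≤g))

  rises-into : ∀ i → 2 ≤ i → i ≤ g → β_ (G i) ≥ γ_ (G i) → R (i ∸ 1) <ᴿ R i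
  rises-into (suc i) (s≤s 1≤i) 1+i≤g upper = subst (λ j → R i <ᴿ R j) i+1≡1+i
    (rises i 1≤i (subst (_≤ g) (sym i+1≡1+i) 1+i≤g) (subst Upper (sym i+1≡1+i) upper))
    where i+1≡1+i = ℕₚ.+-comm i 1

  falls-from : ∀ i → 2 ≤ i → i ≤ g ∸ 1 → β_ (G i) ≤ γ_ (G i) → R (i + 1) <ᴿ R i
  falls-from i 2≤i i≤g∸1 = falls i (ℕₚ.≤-trans (s≤s z≤n) 2≤i)
    (subst (i + 1 ≤_) (ℕₚ.m∸n+n≡m 1≤g) (ℕₚ.+-monoˡ-≤ 1 i≤g∸1))

  open Unimodality (_≤ᴿ_) ≤ᴿ-total R Upper (λ i → γ_ (G i) ≤? β_ (G i)) g Upper-downward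
    (λ i 1≤i i+1≤g upper → <ᴿ⇒≤ᴿ {R i} {R (i + 1)} (rises i 1≤i i+1≤g upper))
    (λ i 1≤i i+1≤g ¬upper → <ᴿ⇒≤ᴿ {R (i + 1)} {R i} (falls i 1≤i i+1≤g (ℕₚ.<⇒≤ (ℕₚ.≰⇒> ¬upper))))
    public using (unimodal)

lemma3p3 : (κ λ' g : ℕ) → 3 ≤ κ → λ' ≤ κ ∸ 2 → (G : ℕ → Triple) → Graphical κ λ' g G →
    let R = λ i → 𝔑 (G i) in
    (∀ i → 1 ≤ i → i ≤ g →
       (R 1 ≤ᴿ R i) ×
       ((R i ≈ᴿ R 1 → (G i ≡ (1 , λ' , κ ∸ λ' ∸ 1)) ⊎ (G i ≡ (κ ∸ λ' ∸ 1 , λ' , 1))) ×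
        ((G i ≡ (1 , λ' , κ ∸ λ' ∸ 1)) ⊎ (G i ≡ (κ ∸ λ' ∸ 1 , λ' , 1)) → R i ≈ᴿ R 1))) ×
    (∀ i → 2 ≤ i → i ≤ g → β_ (G i) ≥ γ_ (G i) → R (i ∸ 1) <ᴿ R i) ×
    (∀ i → 2 ≤ i → i ≤ g ∸ 1 → β_ (G i) ≤ γ_ (G i) → R (i + 1) <ᴿ R i) ×
    Σ ℕ (λ t → (1 ≤ t) × (t ≤ g) ×
      (∀ i → 1 ≤ i → i < t → R i ≤ᴿ R (i + 1)) ×
      (∀ i → t ≤ i → i < g → R (i + 1) ≤ᴿ R i))
lemma3p3 κ λ' g 3≤κ λ'≤κ∸2 G 𝒢 = R-minimum , rises-into , falls-from , unimodal 1≤g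
  where
  λ'+2≤κ : λ' + 2 ≤ κ
  λ'+2≤κ = subst (λ' + 2 ≤_) (ℕₚ.m∸n+n≡m (ℕₚ.≤-trans (s≤s (s≤s z≤n)) 3≤κ)) (ℕₚ.+-monoˡ-≤ 2 λ'≤κ∸2)
  open GraphicalSequence 𝒢 λ'+2≤κ
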